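{- Let $G=(V,E)$ be a bipartite regular graph with at least one edge, and let $\Gamma=\{V_1,\ldots,V_\gamma\}$ be a partition of $V$ into nonempty groups. With node utilities, $\mathrm{SF\text{ - }MP}(G,\Gamma)=\mathrm{DF\text{ - }MP}(G,\Gamma)=\mathrm{MP}(G)=1$.
   Context: Max-Cut with node utilities: $G=(V,E)$ is a finite simple graph, $\Delta(G)$ its maximum degree, $N(v)$ the neighborhood of $v$. A cut is $S\subseteq V$; $X_{uv}(S)=1$ if exactly one of $u,v$ lies in $S$ and $0$ otherwise. Node utility: $f_S(v)=\frac{1}{\Delta(G)}\sum_{u\in N(v)}X_{uv}(S)$, $f_S(A)=\sum_{v\in A}f_S(v)$. For a vertex partition $\Gamma=\{V_1,\ldots,V_\gamma\}$: $\mathrm{MP}(G)=\max_{S}f_S(V)/|V|$, $\mathrm{SF\text{ - }MP}(G,\Gamma)=\max_S\min_{i\in[\gamma]}f_S(V_i)/|V_i|$, $\mathrm{DF\text{ - }MP}(G,\Gamma)=\max_D\min_{i\in[\gamma]}\mathbb{E}_{S\sim D}f_S(V_i)/|V_i|$, where $D$ ranges over probability distributions on subsets of $V$.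
   Formalization: In DF-MP(G,Γ), the probability distributions D on subsets of V have rational weights. -}

module Defs where

open import Data.Bool using (Bool; true; false; if_then_else_; _xor_)
open import Data.Nat as ℕ using (ℕ; zero; suc; _⊔_)
open import Data.Fin using (Fin; zero; suc; _≟_)
open import Data.List using (List; []; _∷_; foldr; map; allFin)
open import Data.Nat.ListAction using (sum)
open import Data.Integer using (+_)
open import Data.Rational as ℚ using (ℚ; 0ℚ; 1ℚ; _≤_; _⊓_; _/_)
open import Data.Product using (Σ; ∃; _×_; _,_; proj₁)
open import Data.List.Membership.Propositional using (_∈_)
open import Relation.Binary.PropositionalEquality using (_≡_; _≢_)
open import Relation.Nullary.Decidable using (⌊_⌋)

record Graph (n : ℕ) : Set where
  field
    adj    : Fin n → Fin n → Bool
    sym    : ∀ u v → adj u v ≡ adj v u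
    irrefl : ∀ v → adj v v ≡ false
open Graph public

count : ∀ {n} → (Fin n → Bool) → ℕ
count {n} p = sum (map (λ u → if p u then 1 else 0) (allFin n))

degree : ∀ {n} → Graph n → Fin n → ℕ
degree G v = count (adj G v)

maxDegree : ∀ {n} → Graph n → ℕ
maxDegree {n} G = foldr _⊔_ 0 (map (degree G) (allFin n))

HasEdge : ∀ {n} → Graph n → Set
HasEdge G = ∃ λ u → ∃ λ v → adj G u v ≡ true

IsRegular : ∀ {n} → Graph n → Set
IsRegular G = ∃ λ d → ∀ v → degree G v ≡ d

IsBipartite : ∀ {n} → Graph n → Set
IsBipartite {n} G =
  Σ (Fin n → Bool) λ c → ∀ u v → adj G u v ≡ true → c u ≢ c v

-- Vertex partitions Γ = {V_1,…,V_γ} into nonempty groups,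
-- given by the group-assignment map  group : Fin n → Fin γ.

record Partition (n γ : ℕ) : Set where
  field
    group    : Fin n → Fin γ
    nonempty : ∀ (i : Fin γ) → ∃ λ v → group v ≡ i
open Partition public

member : ∀ {n γ} → Partition n γ → Fin γ → Fin n → Bool
member Γ i v = ⌊ group Γ v ≟ i ⌋

-- a / b for naturals, with the junk value 0 when b = 0
_÷ℕ_ : ℕ → ℕ → ℚ
a ÷ℕ zero  = 0ℚ
a ÷ℕ suc b = (+ a) / suc b

-- p / b for p rational, b natural (junk value 0 when b = 0)
_÷ℚℕ_ : ℚ → ℕ → ℚ
p ÷ℚℕ zero  = 0ℚ
p ÷ℚℕ suc b = p ℚ.* ((+ 1) / suc b)

sumℚ : ∀ {n} → (Fin n → ℚ) → ℚ
sumℚ {n} f = foldr ℚ._+_ 0ℚ (map f (allFin n))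

-- minimum over the index set Fin k (junk value 0 for k = 0)
minFin : ∀ {k} → (Fin k → ℚ) → ℚ
minFin {zero}        f = 0ℚ
minFin {suc zero}    f = f zero
minFin {suc (suc k)} f = f zero ⊓ minFin (λ i → f (suc i))

IsMaxOf : (A : Set) → (A → ℚ) → ℚ → Set
IsMaxOf A F r = (∃ λ a → F a ≡ r) × (∀ a → F a ≤ r)

Cut : ℕ → Set
Cut n = Fin n → Bool

X : ∀ {n} → Cut n → Fin n → Fin n → Bool
X S u v = S u xor S v

f : ∀ {n} → Graph n → Cut n → Fin n → ℚ
f G S v = count (λ u → if adj G v u then X S u v else false) ÷ℕ maxDegree G

fSet : ∀ {n} → Graph n → Cut n → (Fin n → Bool) → ℚ
fSet G S A = sumℚ (λ v → if A v then f G S v else 0ℚ)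

groupAvg : ∀ {n γ} → Graph n → Partition n γ → Cut n → Fin γ → ℚ
groupAvg G Γ S i = fSet G S (member Γ i) ÷ℚℕ count (member Γ i)

record Distribution (n : ℕ) : Set where
  field
    support  : List (ℚ × Cut n)
    nonneg   : ∀ {w S} → (w , S) ∈ support → 0ℚ ≤ w
    total    : foldr (λ p acc → proj₁ p ℚ.+ acc) 0ℚ support ≡ 1ℚ
open Distribution public

expect : ∀ {n} → Distribution n → (Cut n → ℚ) → ℚ
expect D h = foldr (λ { (w , S) acc → w ℚ.* h S ℚ.+ acc }) 0ℚ (support D)

IsMP : ∀ {n} → Graph n → ℚ → Set
IsMP {n} G r = IsMaxOf (Cut n) (λ S → fSet G S (λ _ → true) ÷ℚℕ n) r

IsSFMP : ∀ {n γ} → Graph n → Partition n γ → ℚ → Set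
IsSFMP {n} G Γ r = IsMaxOf (Cut n) (λ S → minFin (groupAvg G Γ S)) r

IsDFMP : ∀ {n γ} → Graph n → Partition n γ → ℚ → Set
IsDFMP {n} G Γ r =
  IsMaxOf (Distribution n) (λ D → minFin (λ i → expect D (λ S → groupAvg G Γ S i))) r

{-# OPTIONS --safe #-}
module Submission where

-- Every vertex has utility at most 1, since it has at most Δ(G) neighbours across any
-- cut; hence every group average, every expectation of one and every minimum of them is
-- at most 1.  The colour classes of a bipartition cut every edge, so on a d-regular
-- graph with d ≥ 1 (and then Δ(G) = d) that cut gives every vertex utility exactly 1,
-- and the cut itself, as a point mass, attains all three values.

open import Defs hiding (sym)
open import Data.Bool using (Bool; true; false; if_then_else_; _xor_)
open import Data.Fin using (Fin; zero; suc; _≟_)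
open import Data.Fin.Properties using (nonZeroIndex)
open import Data.Integer as ℤ using (+_)
import Data.Integer.Properties as ℤP
open import Data.List using (List; []; _∷_; foldr; map; allFin; length)
import Data.List.Properties as ListP
open import Data.List.Membership.Propositional using (_∈_)
open import Data.List.Membership.Propositional.Properties using (∈-allFin)
open import Data.List.Relation.Unary.Any using (here; there)
open import Data.Nat as ℕ using (ℕ; zero; suc; _⊔_; z≤n; s≤s; NonZero)
open import Data.Nat.ListAction using (sum)
import Data.Nat.Properties as ℕP
open import Data.Product using (_×_; _,_; proj₁; proj₂)
open import Data.Rational as ℚ using (ℚ; 0ℚ; 1ℚ; _≤_; _⊓_; _/_; toℚᵘ)
import Data.Rational.Properties as ℚP
open import Data.Rational.Unnormalised as ℚᵘ using (mkℚᵘ; *≡*; *≤*)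
import Data.Rational.Unnormalised.Properties as ℚᵘP
open import Data.Unit using (tt)
open import Function using (_∘_)
open import Relation.Binary.PropositionalEquality
open import Relation.Nullary using (contradiction)
open import Relation.Nullary.Decidable using (dec-true; isYes≗does)

fromℕ : ℕ → ℚ
fromℕ k = + k / 1

toℚᵘ-/ : ∀ i d → toℚᵘ (i / suc d) ℚᵘ.≃ mkℚᵘ i d
toℚᵘ-/ i d = ℚP.toℚᵘ-fromℚᵘ (mkℚᵘ i d)

fromℕ-suc : ∀ k → fromℕ (suc k) ≡ 1ℚ ℚ.+ fromℕ k
fromℕ-suc k = ℚP.toℚᵘ-injective (begin
  toℚᵘ (fromℕ (suc k))             ≈⟨ toℚᵘ-/ (+ suc k) 0 ⟩
  mkℚᵘ (+ suc k) 0                 ≈⟨ *≡* (trans (ℤP.*-identityʳ _)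
                                       (sym (trans (ℤP.*-identityʳ _)
                                         (cong (ℤ._+_ (+ 1)) (ℤP.*-identityʳ (+ k)))))) ⟩
  mkℚᵘ (+ 1) 0 ℚᵘ.+ mkℚᵘ (+ k) 0   ≈⟨ ℚᵘP.+-congʳ _ (toℚᵘ-/ (+ k) 0) ⟨
  toℚᵘ 1ℚ ℚᵘ.+ toℚᵘ (fromℕ k)      ≈⟨ ℚP.toℚᵘ-homo-+ 1ℚ (fromℕ k) ⟨
  toℚᵘ (1ℚ ℚ.+ fromℕ k)            ∎)
  where open ℚᵘP.≃-Reasoning

/-≤1 : ∀ {a b} → a ℕ.≤ suc b → + a / suc b ≤ 1ℚ
/-≤1 {a} {b} a≤1+b = ℚP.toℚᵘ-cancel-≤ (ℚᵘP.≤-respˡ-≃ (ℚᵘP.≃-sym (toℚᵘ-/ (+ a) b))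
  (*≤* (subst₂ ℤ._≤_ (sym (ℤP.*-identityʳ (+ a))) (sym (ℤP.*-identityˡ (+ suc b)))
    (ℤ.+≤+ a≤1+b))))

[1+n]/[1+n]≡1 : ∀ b → + suc b / suc b ≡ 1ℚ
[1+n]/[1+n]≡1 b = ℚP.toℚᵘ-injective
  (ℚᵘP.≃-trans (toℚᵘ-/ (+ suc b) b) (*≡* (ℤP.*-comm (+ suc b) (+ 1))))

i/1*1/n≡i/n : ∀ i b → (i / 1) ℚ.* (+ 1 / suc b) ≡ i / suc b
i/1*1/n≡i/n i b = ℚP.toℚᵘ-injective (begin
  toℚᵘ ((i / 1) ℚ.* (+ 1 / suc b))         ≈⟨ ℚP.toℚᵘ-homo-* (i / 1) (+ 1 / suc b) ⟩
  toℚᵘ (i / 1) ℚᵘ.* toℚᵘ (+ 1 / suc b)    ≈⟨ ℚᵘP.*-cong (toℚᵘ-/ i 0) (toℚᵘ-/ (+ 1) b) ⟩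
  mkℚᵘ i 0 ℚᵘ.* mkℚᵘ (+ 1) b              ≈⟨ *≡* (ℤP.*-assoc i (+ 1) (+ suc b)) ⟩
  mkℚᵘ i b                                ≈⟨ toℚᵘ-/ i b ⟨
  toℚᵘ (i / suc b)                        ∎)
  where open ℚᵘP.≃-Reasoning

fromℕ÷ℚℕn≡1 : ∀ m .{{_ : NonZero m}} → fromℕ m ÷ℚℕ m ≡ 1ℚ
fromℕ÷ℚℕn≡1 (suc b) = trans (i/1*1/n≡i/n (+ suc b) b) ([1+n]/[1+n]≡1 b)

n÷ℕn≡1 : ∀ m .{{_ : NonZero m}} → m ÷ℕ m ≡ 1ℚ
n÷ℕn≡1 (suc b) = [1+n]/[1+n]≡1 b

÷ℕ-≤1 : ∀ {a} m → a ℕ.≤ m → a ÷ℕ m ≤ 1ℚ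
÷ℕ-≤1 zero    _ = ℚP.≤ᵇ⇒≤ tt
÷ℕ-≤1 (suc b) a≤m = /-≤1 a≤m

÷ℚℕ-≤1 : ∀ {p} m → p ≤ fromℕ m → p ÷ℚℕ m ≤ 1ℚ
÷ℚℕ-≤1 zero    _ = ℚP.≤ᵇ⇒≤ tt
÷ℚℕ-≤1 {p} (suc b) p≤m = begin
  p ℚ.* (+ 1 / suc b)                ≤⟨ ℚP.*-monoʳ-≤-nonNeg (+ 1 / suc b) p≤m ⟩
  fromℕ (suc b) ℚ.* (+ 1 / suc b)    ≡⟨ fromℕ÷ℚℕn≡1 (suc b) ⟩
  1ℚ                                 ∎
  where
  open ℚP.≤-Reasoning
  instance
    1/[1+b]-nonNeg : ℚ.NonNegative (+ 1 / suc b)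
    1/[1+b]-nonNeg = ℚP.normalize-nonNeg 1 (suc b)

if-false⇒cond : ∀ {b c} → (if b then c else false) ≡ true → b ≡ true
if-false⇒cond {true} _ = refl

xor-≢ : ∀ {a b} → a ≢ b → a xor b ≡ true
xor-≢ {true}  {true}  a≢b = contradiction refl a≢b
xor-≢ {true}  {false} _   = refl
xor-≢ {false} {true}  _   = refl
xor-≢ {false} {false} a≢b = contradiction refl a≢b

-- Defs.count, fSet and expect are, definitionally, countIn, sumIn and weightedSum
-- over allFin n and over the support of the distribution.
module _ {A : Set} where

  countIn : (A → Bool) → List A → ℕ
  countIn p xs = sum (map (λ x → if p x then 1 else 0) xs)

  countIn-mono : ∀ {p q} → (∀ x → p x ≡ true → q x ≡ true) →
                 ∀ xs → countIn p xs ℕ.≤ countIn q xs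
  countIn-mono p⇒q [] = z≤n
  countIn-mono {p} {q} p⇒q (x ∷ xs) with p x in px | q x in qx
  ... | true  | true  = s≤s (countIn-mono p⇒q xs)
  ... | true  | false = contradiction (trans (sym (p⇒q x px)) qx) λ ()
  ... | false | true  = ℕP.m≤n⇒m≤1+n (countIn-mono p⇒q xs)
  ... | false | false = countIn-mono p⇒q xs

  countIn-cong : ∀ {p q} → (∀ x → p x ≡ q x) → ∀ xs → countIn p xs ≡ countIn q xs
  countIn-cong p≗q xs =
    cong sum (ListP.map-cong (λ x → cong (if_then 1 else 0) (p≗q x)) xs)

  countIn-pos : ∀ {p x xs} → x ∈ xs → p x ≡ true → 0 ℕ.< countIn p xs
  countIn-pos (here refl) px rewrite px = s≤s z≤n
  countIn-pos (there x∈xs) px = ℕP.≤-trans (countIn-pos x∈xs px) (ℕP.m≤n+m _ _)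

  countIn-true : ∀ xs → countIn (λ _ → true) xs ≡ length xs
  countIn-true []       = refl
  countIn-true (_ ∷ xs) = cong suc (countIn-true xs)

  sumIn : (A → Bool) → (A → ℚ) → List A → ℚ
  sumIn P g xs = foldr ℚ._+_ 0ℚ (map (λ x → if P x then g x else 0ℚ) xs)

  sumIn-mono-≤ : ∀ {P g h} → (∀ x → g x ≤ h x) → ∀ xs → sumIn P g xs ≤ sumIn P h xs
  sumIn-mono-≤ g≤h [] = ℚP.≤-refl
  sumIn-mono-≤ {P} g≤h (x ∷ xs) with P x
  ... | true  = ℚP.+-mono-≤ (g≤h x) (sumIn-mono-≤ g≤h xs)
  ... | false = ℚP.+-monoʳ-≤ 0ℚ (sumIn-mono-≤ g≤h xs)

  sumIn-cong : ∀ {P g h} → (∀ x → g x ≡ h x) → ∀ xs → sumIn P g xs ≡ sumIn P h xs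
  sumIn-cong {P} g≗h xs =
    cong (foldr ℚ._+_ 0ℚ) (ListP.map-cong (λ x → cong (if P x then_else 0ℚ) (g≗h x)) xs)

  sumIn-one : ∀ P xs → sumIn P (λ _ → 1ℚ) xs ≡ fromℕ (countIn P xs)
  sumIn-one P [] = refl
  sumIn-one P (x ∷ xs) with P x
  ... | true  = trans (cong (1ℚ ℚ.+_) (sumIn-one P xs)) (sym (fromℕ-suc (countIn P xs)))
  ... | false = trans (ℚP.+-identityˡ _) (sumIn-one P xs)

  ∈⇒≤foldr-⊔ : ∀ (g : A → ℕ) {x xs} → x ∈ xs → g x ℕ.≤ foldr _⊔_ 0 (map g xs)
  ∈⇒≤foldr-⊔ g {x} (here refl)  = ℕP.m≤m⊔n (g x) _
  ∈⇒≤foldr-⊔ g (there {y} x∈xs) = ℕP.m≤n⇒m≤o⊔n (g y) (∈⇒≤foldr-⊔ g x∈xs)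

  foldr-⊔-lub : ∀ (g : A → ℕ) {d} → (∀ x → g x ℕ.≤ d) → ∀ xs → foldr _⊔_ 0 (map g xs) ℕ.≤ d
  foldr-⊔-lub g g≤d []       = z≤n
  foldr-⊔-lub g g≤d (x ∷ xs) = ℕP.⊔-lub (g≤d x) (foldr-⊔-lub g g≤d xs)

  weightedSum : (A → ℚ) → List (ℚ × A) → ℚ
  weightedSum h = foldr (λ p acc → proj₁ p ℚ.* h (proj₂ p) ℚ.+ acc) 0ℚ

  totalWeight : List (ℚ × A) → ℚ
  totalWeight = foldr (λ p acc → proj₁ p ℚ.+ acc) 0ℚ

  weightedSum≤totalWeight : ∀ {h} → (∀ x → h x ≤ 1ℚ) → ∀ ws →
    (∀ {w x} → (w , x) ∈ ws → 0ℚ ≤ w) → weightedSum h ws ≤ totalWeight ws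
  weightedSum≤totalWeight h≤1 [] _ = ℚP.≤-refl
  weightedSum≤totalWeight {h} h≤1 ((w , x) ∷ ws) ws≥0 =
    ℚP.+-mono-≤ w*hx≤w (weightedSum≤totalWeight h≤1 ws (ws≥0 ∘ there))
    where
    instance
      w-nonNeg : ℚ.NonNegative w
      w-nonNeg = ℚ.nonNegative (ws≥0 (here refl))
    w*hx≤w : w ℚ.* h x ≤ w
    w*hx≤w = subst (w ℚ.* h x ≤_) (ℚP.*-identityʳ w) (ℚP.*-monoˡ-≤-nonNeg w (h≤1 x))

minFin-≤ : ∀ {k} {F : Fin k → ℚ} {r} → Fin k → (∀ i → F i ≤ r) → minFin F ≤ r
minFin-≤ {suc zero}    _ F≤r = F≤r zero
minFin-≤ {suc (suc k)} _ F≤r = ℚP.≤-trans (ℚP.p⊓q≤p _ _) (F≤r zero)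

minFin-const : ∀ {k} {F : Fin k → ℚ} {r} → Fin k → (∀ i → F i ≡ r) → minFin F ≡ r
minFin-const {suc zero}    _ F≡r = F≡r zero
minFin-const {suc (suc k)} {r = r} _ F≡r =
  trans (cong₂ _⊓_ (F≡r zero) (minFin-const zero (F≡r ∘ suc))) (ℚP.⊓-idem r)

module _ {n : ℕ} where

  expect-≤1 : ∀ (D : Distribution n) {h} → (∀ S → h S ≤ 1ℚ) → expect D h ≤ 1ℚ
  expect-≤1 D h≤1 =
    subst (expect D _ ≤_) (total D) (weightedSum≤totalWeight h≤1 (support D) (nonneg D))

  pointMass : Cut n → Distribution n
  pointMass S = record
    { support = (1ℚ , S) ∷ []
    ; nonneg  = λ { (here refl) → ℚP.≤ᵇ⇒≤ tt }
    ; total   = ℚP.+-identityʳ 1ℚ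
    }

  expect-pointMass : ∀ S h → expect (pointMass S) h ≡ h S
  expect-pointMass S h = trans (ℚP.+-identityʳ (1ℚ ℚ.* h S)) (ℚP.*-identityˡ (h S))

  count-true : count {n} (λ _ → true) ≡ n
  count-true = trans (countIn-true (allFin n)) (ListP.length-tabulate (λ i → i))

  count-member-pos : ∀ {γ} (Γ : Partition n γ) i → 0 ℕ.< count (member Γ i)
  count-member-pos Γ i with nonempty Γ i
  ... | v , v∈Vᵢ = countIn-pos (∈-allFin v)
    (trans (isYes≗does (group Γ v ≟ i)) (dec-true (group Γ v ≟ i) v∈Vᵢ))

module _ {n : ℕ} (G : Graph n) where

  IsProperColouring : Cut n → Set
  IsProperColouring c = ∀ u v → adj G u v ≡ true → c u ≢ c v

  degree≤maxDegree : ∀ v → degree G v ℕ.≤ maxDegree G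
  degree≤maxDegree v = ∈⇒≤foldr-⊔ (degree G) (∈-allFin v)

  maxDegree-regular : ∀ {d} → (∀ v → degree G v ≡ d) → Fin n → maxDegree G ≡ d
  maxDegree-regular regular v = ℕP.≤-antisym
    (foldr-⊔-lub (degree G) (ℕP.≤-reflexive ∘ regular) (allFin n))
    (subst (ℕ._≤ maxDegree G) (regular v) (degree≤maxDegree v))

  f≤1 : ∀ S v → f G S v ≤ 1ℚ
  f≤1 S v = ÷ℕ-≤1 (maxDegree G) (ℕP.≤-trans
    (countIn-mono (λ u → if-false⇒cond {adj G v u}) (allFin n))
    (degree≤maxDegree v))

  crossing≡adj : ∀ {c} → IsProperColouring c →
                 ∀ v u → (if adj G v u then X c u v else false) ≡ adj G v u
  crossing≡adj proper v u with adj G v u in vu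
  ... | true  = xor-≢ (proper u v (trans (Graph.sym G u v) vu))
  ... | false = refl

  f-proper≡1 : ∀ {c d} → IsProperColouring c → (∀ v → degree G v ≡ d) → HasEdge G →
               ∀ v → f G c v ≡ 1ℚ
  f-proper≡1 {c} {d} proper regular (u , w , uw) v = begin
    f G c v  ≡⟨ cong₂ _÷ℕ_ (trans (countIn-cong (crossing≡adj proper v) (allFin n)) (regular v))
                           (maxDegree-regular regular u) ⟩
    d ÷ℕ d   ≡⟨ n÷ℕn≡1 d ⟩
    1ℚ       ∎
    where
    open ≡-Reasoning
    instance
      d-nonZero : NonZero d
      d-nonZero = ℕ.>-nonZero (subst (0 ℕ.<_) (regular u) (countIn-pos (∈-allFin w) uw))

  fSet÷count≤1 : ∀ S A → fSet G S A ÷ℚℕ count A ≤ 1ℚ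
  fSet÷count≤1 S A = ÷ℚℕ-≤1 (count A)
    (ℚP.≤-trans (sumIn-mono-≤ (f≤1 S) (allFin n)) (ℚP.≤-reflexive (sumIn-one A (allFin n))))

  fSet÷count≡1 : ∀ S → (∀ v → f G S v ≡ 1ℚ) → ∀ A → .{{_ : NonZero (count A)}} →
                 fSet G S A ÷ℚℕ count A ≡ 1ℚ
  fSet÷count≡1 S f≡1 A = trans
    (cong (_÷ℚℕ count A) (trans (sumIn-cong {g = f G S} f≡1 (allFin n)) (sumIn-one A (allFin n))))
    (fromℕ÷ℚℕn≡1 (count A))

  fSet-all÷n≤1 : ∀ S → fSet G S (λ _ → true) ÷ℚℕ n ≤ 1ℚ
  fSet-all÷n≤1 S = subst (λ m → fSet G S (λ _ → true) ÷ℚℕ m ≤ 1ℚ) (count-true {n})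
    (fSet÷count≤1 S (λ _ → true))

  fSet-all÷n≡1 : ∀ S → (∀ v → f G S v ≡ 1ℚ) → Fin n → fSet G S (λ _ → true) ÷ℚℕ n ≡ 1ℚ
  fSet-all÷n≡1 S f≡1 v = subst (λ m → fSet G S (λ _ → true) ÷ℚℕ m ≡ 1ℚ) (count-true {n})
    (fSet÷count≡1 S f≡1 (λ _ → true) {{subst NonZero (sym (count-true {n})) (nonZeroIndex v)}})

proposition4p11 : ∀ {n γ} (G : Graph n) (Γ : Partition n γ) →
    IsBipartite G → IsRegular G → HasEdge G →
    IsSFMP G Γ 1ℚ × IsDFMP G Γ 1ℚ × IsMP G 1ℚ
proposition4p11 {n} {γ} G Γ (c , proper) (_ , regular) edge@(u , _) =
  ((c , minFin-const i₀ groupAvg≡1) , λ S → minFin-≤ i₀ (groupAvg≤1 S)) ,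
  ((pointMass c , minFin-const i₀ (λ i → trans (expect-pointMass c (avg i)) (groupAvg≡1 i))) ,
   λ D → minFin-≤ i₀ (λ i → expect-≤1 D (λ S → groupAvg≤1 S i))) ,
  ((c , fSet-all÷n≡1 G c f≡1 u) , fSet-all÷n≤1 G)
  where
  i₀ : Fin γ
  i₀ = group Γ u
  avg : Fin γ → Cut n → ℚ
  avg i S = groupAvg G Γ S i
  f≡1 : ∀ v → f G c v ≡ 1ℚ
  f≡1 = f-proper≡1 G proper regular edge
  groupAvg≤1 : ∀ S i → groupAvg G Γ S i ≤ 1ℚ
  groupAvg≤1 S i = fSet÷count≤1 G S (member Γ i)
  groupAvg≡1 : ∀ i → groupAvg G Γ c i ≡ 1ℚ
  groupAvg≡1 i = fSet÷count≡1 G c f≡1 (member Γ i) {{ℕ.>-nonZero (count-member-pos Γ i)}}
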